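{- For every graph $G$ (simple, finite, with at least one edge), $\lceil \operatorname{dc}_1(G)\rceil=\operatorname{pw}_1(G)\le\operatorname{re}_1(G)$.
   Context: A one-dimensional representation of $G=(V,E)$ is a function $\rho:V\to\mathbb{R}$. It is non-edge-degenerate (NED) if $\rho(u)\ne\rho(v)$ for every edge $uv\in E$, and non-vertex-degenerate (NVD) if injective. $V_2(G)$ is the set of 2-element subsets of $V$. Define $\operatorname{dc}_1(G)=\min_\rho \frac{\max_{uv\in E}|\rho(u)-\rho(v)|}{\min_{uv\in E}|\rho(u)-\rho(v)|}$ over NED one-dimensional $\rho$; $\operatorname{pw}_1(G)=\min_\rho \frac{\max_{uv\in V_2(G)}|\rho(u)-\rho(v)|}{\min_{uv\in E}|\rho(u)-\rho(v)|}$ over NED one-dimensional $\rho$; $\operatorname{re}_1(G)=\min_\rho \frac{\max_{uv\in E}|\rho(u)-\rho(v)|}{\min_{uv\in V_2(G)}|\rho(u)-\rho(v)|}$ over NVD one-dimensional $\rho$.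
   Formalization: The one-dimensional representations ρ take values in ℚ instead of ℝ, so dc₁(G), pw₁(G) and re₁(G) are minima over rational representations. -}

module Defs where

open import Data.Nat using (ℕ)
open import Data.Bool using (Bool; true; false; if_then_else_; _∧_)
open import Data.Fin using (Fin; toℕ)
open import Data.List using (List; []; _∷_; [_]; concatMap; map; foldr)
open import Data.List.Base using (allFin)
open import Data.Product using (Σ; _×_; _,_; ∃)
open import Data.Rational using (ℚ; 0ℚ; _-_; _*_; _≤_; ∣_∣; _⊔_; _⊓_)
open import Relation.Binary.PropositionalEquality using (_≡_; _≢_)
open import Function.Definitions using (Injective)
import Data.Nat as ℕ

record Graph (n : ℕ) : Set where
  field
    adj    : Fin n → Fin n → Bool
    sym    : ∀ i j → adj i j ≡ adj j i
    irrefl : ∀ i → adj i i ≡ false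
open Graph public

HasEdge : ∀ {n} → Graph n → Set
HasEdge {n} G = Σ (Fin n) λ i → Σ (Fin n) λ j → adj G i j ≡ true

-- all 2-element subsets {i,j}, represented as pairs with i < j
pairs : (n : ℕ) → List (Fin n × Fin n)
pairs n = concatMap (λ i → concatMap (λ j →
            if toℕ i ℕ.<ᵇ toℕ j then [ (i , j) ] else []) (allFin n)) (allFin n)

edges : ∀ {n} → Graph n → List (Fin n × Fin n)
edges {n} G = concatMap (λ i → concatMap (λ j →
            if (toℕ i ℕ.<ᵇ toℕ j) ∧ adj G i j then [ (i , j) ] else []) (allFin n)) (allFin n)

Rep : ℕ → Set
Rep n = Fin n → ℚ

dist : ∀ {n} → Rep n → Fin n × Fin n → ℚ
dist ρ (i , j) = ∣ ρ i - ρ j ∣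

-- maximum of a list of nonnegative rationals (0 for the empty list)
maxL : List ℚ → ℚ
maxL = foldr _⊔_ 0ℚ

-- minimum of a nonempty list (0 for the empty list, never used)
minL : List ℚ → ℚ
minL []       = 0ℚ
minL (x ∷ xs) = foldr _⊓_ x xs

maxOver minOver : ∀ {n} → List (Fin n × Fin n) → Rep n → ℚ
maxOver ps ρ = maxL (map (dist ρ) ps)
minOver ps ρ = minL (map (dist ρ) ps)

NED : ∀ {n} → Graph n → Rep n → Set
NED G ρ = ∀ i j → adj G i j ≡ true → ρ i ≢ ρ j

NVD : ∀ {n} → Rep n → Set
NVD ρ = Injective _≡_ _≡_ ρ

-- t is the minimum, over admissible ρ, of the ratio num ρ / den ρ
-- (den ρ > 0 for every admissible ρ, so "t ≤ num/den" is "t * den ≤ num").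
IsMinRatio : ∀ {n} → (Rep n → Set) → (Rep n → ℚ) → (Rep n → ℚ) → ℚ → Set
IsMinRatio {n} Adm num den t =
  (Σ (Rep n) λ ρ → Adm ρ × num ρ ≡ t * den ρ) ×
  (∀ ρ → Adm ρ → t * den ρ ≤ num ρ)

IsDc1 IsPw1 IsRe1 : ∀ {n} → Graph n → ℚ → Set
IsDc1 {n} G = IsMinRatio (NED G) (maxOver (edges G)) (minOver (edges G))
IsPw1 {n} G = IsMinRatio (NED G) (maxOver (pairs n)) (minOver (edges G))
IsRe1 {n} G = IsMinRatio NVD (maxOver (edges G)) (minOver (pairs n))

{-# OPTIONS --safe #-}
-- A proper colouring of G with colours 0, …, K, read as a representation, has every edge of
-- length at least 1 and every pair at distance at most K, so dc₁ G ≤ K and pw₁ G ≤ K.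
-- Conversely, rescale an optimal representation so that its shortest edge (for dc₁ and pw₁)
-- or its closest pair (for re₁) has length 1, and shift its leftmost vertex to 0.  Label each
-- vertex by the integer part of its position (for dc₁ and pw₁), or by the number of vertices
-- strictly to its left (for re₁: a half-open window of length K holds at most K vertices
-- that are pairwise at distance ≥ 1).  Along every edge the labels then increase by between
-- 1 and K, for K = ⌈dc₁⌉, ⌊pw₁⌋ and ⌊re₁⌋ respectively, so the labels modulo K + 1 form a
-- proper colouring with colours 0, …, K.  Hence pw₁ ≤ ⌈dc₁⌉, ⌈dc₁⌉ ≤ ⌊pw₁⌋ ≤ pw₁ and
-- pw₁ ≤ ⌊re₁⌋ ≤ re₁.
module Submission where

open import Defs hiding (sym)

open import Data.Bool using (Bool; true; T; if_then_else_)
open import Data.Bool.Properties using (T-∧; T-≡)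
open import Data.Empty using (⊥; ⊥-elim)
open import Data.Fin as Fin using (Fin; toℕ; zero)
import Data.Fin.Properties as FinP
open import Data.Integer as ℤ using (ℤ; +_; -[1+_]; 0ℤ; 1ℤ)
import Data.Integer.DivMod as ℤDM
import Data.Integer.Properties as ℤP
open import Data.List using (List; []; _∷_; [_]; map; concatMap; allFin)
open import Data.List.Membership.Propositional using (_∈_)
open import Data.List.Membership.Propositional.Properties
  using (∈-map⁺; ∈-map⁻; ∈-concatMap⁺; ∈-concatMap⁻; ∈-allFin; foldr-selective)
open import Data.List.Properties using (foldr-preservesᵇ; foldr-preservesʳ; foldr-preservesᵒ)
open import Data.List.Relation.Unary.All as All using (All)
import Data.List.Relation.Unary.All.Properties as All
open import Data.List.Relation.Unary.Any as Any using (here; there)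
open import Data.Nat as ℕ using (ℕ; zero; suc)
import Data.Nat.Coprimality as Coprimality
open import Data.Nat.DivMod as ℕDM using (_%_)
open import Data.Nat.Divisibility using (_∣_; divides; ∣⇒≤)
import Data.Nat.Properties as ℕP
open import Data.Product as Product using (_×_; _,_; proj₁; proj₂)
open import Data.Rational hiding (truncate)
open import Data.Rational.Properties
open import Data.Sum as Sum using (_⊎_; inj₁; inj₂; [_,_]′)
open import Function using (_∘_; Equivalence)
open import Relation.Binary using (tri<; tri≈; tri>)
open import Relation.Binary.Bundles using (DecTotalOrder)
open import Relation.Binary.PropositionalEquality hiding ([_])
open import Relation.Nullary using (¬_; Dec; yes; no; contradiction)

open import Algebra.Properties.Group +-0-group using (⁻¹-involutive)
open import Algebra.Properties.Monoid.Sum ℕP.+-0-monoid using (sum)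
import Data.List.Extrema (DecTotalOrder.totalOrder ≤-decTotalOrder) as Extrema
open import Data.Rational.Solver using (module +-*-Solver)
open +-*-Solver

∣p-q∣≡∣q-p∣ : ∀ p q → ∣ p - q ∣ ≡ ∣ q - p ∣
∣p-q∣≡∣q-p∣ p q = trans (cong ∣_∣ (solve 2 (λ p q → p :- q := :- (q :- p)) refl p q)) (∣-p∣≡∣p∣ (q - p))

p≤q⇒0≤q-p : ∀ {p q} → p ≤ q → 0ℚ ≤ q - p
p≤q⇒0≤q-p {p} {q} p≤q = subst (_≤ q - p) (+-inverseʳ p) (+-monoˡ-≤ (- p) p≤q)

module _ {p q : ℚ} where

  p≤q⇒∣p-q∣≡q-p : p ≤ q → ∣ p - q ∣ ≡ q - p
  p≤q⇒∣p-q∣≡q-p p≤q = trans (∣p-q∣≡∣q-p∣ p q) (0≤p⇒∣p∣≡p (p≤q⇒0≤q-p p≤q))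

  private
    p+[q-p]≡q : p + (q - p) ≡ q
    p+[q-p]≡q = solve 2 (λ p q → p :+ (q :- p) := q) refl p q

  module _ (p≤q : p ≤ q) {r : ℚ} where

    r≤∣p-q∣⇒p+r≤q : r ≤ ∣ p - q ∣ → p + r ≤ q
    r≤∣p-q∣⇒p+r≤q r≤∣p-q∣ = subst (p + r ≤_) p+[q-p]≡q
      (+-monoʳ-≤ p (subst (r ≤_) (p≤q⇒∣p-q∣≡q-p p≤q) r≤∣p-q∣))

    ∣p-q∣≤r⇒q≤p+r : ∣ p - q ∣ ≤ r → q ≤ p + r
    ∣p-q∣≤r⇒q≤p+r ∣p-q∣≤r = subst (_≤ p + r) p+[q-p]≡q
      (+-monoʳ-≤ p (subst (_≤ r) (p≤q⇒∣p-q∣≡q-p p≤q) ∣p-q∣≤r))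

    ∣p-q∣<r⇒q<p+r : ∣ p - q ∣ < r → q < p + r
    ∣p-q∣<r⇒q<p+r ∣p-q∣<r = subst (_< p + r) p+[q-p]≡q
      (+-monoʳ-< p (subst (_< r) (p≤q⇒∣p-q∣≡q-p p≤q) ∣p-q∣<r))

    p+r≤q⇒r≤∣p-q∣ : p + r ≤ q → r ≤ ∣ p - q ∣
    p+r≤q⇒r≤∣p-q∣ p+r≤q = subst (r ≤_) (sym (p≤q⇒∣p-q∣≡q-p p≤q))
      (subst (_≤ q - p) (solve 2 (λ p r → p :+ r :- p := r) refl p r) (+-monoˡ-≤ (- p) p+r≤q))

+-cancelʳ-< : ∀ {p q} r → p + r < q + r → p < q
+-cancelʳ-< {p} {q} r p+r<q+r = subst₂ _<_ (cancel p) (cancel q) (+-monoˡ-< (- r) p+r<q+r)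
  where
  cancel : ∀ x → x + r - r ≡ x
  cancel x = solve 2 (λ x r → x :+ r :- r := x) refl x r

0≤p⇒q-p≤q : ∀ {p q} → 0ℚ ≤ p → q - p ≤ q
0≤p⇒q-p≤q {p} {q} 0≤p = subst (q - p ≤_) (+-identityʳ q) (+-monoʳ-≤ q (neg-antimono-≤ 0≤p))

0≤p,q≤r⇒∣p-q∣≤r : ∀ {p q r} → 0ℚ ≤ p → p ≤ r → 0ℚ ≤ q → q ≤ r → ∣ p - q ∣ ≤ r
0≤p,q≤r⇒∣p-q∣≤r {p} {q} {r} 0≤p p≤r 0≤q q≤r with ≤-total p q
... | inj₁ p≤q = subst (_≤ r) (sym (p≤q⇒∣p-q∣≡q-p p≤q)) (≤-trans (0≤p⇒q-p≤q 0≤p) q≤r)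
... | inj₂ q≤p = subst (_≤ r) (trans (sym (p≤q⇒∣p-q∣≡q-p q≤p)) (∣p-q∣≡∣q-p∣ q p)) (≤-trans (0≤p⇒q-p≤q 0≤q) p≤r)

≢⇒0<∣p-q∣ : ∀ {p q} → p ≢ q → 0ℚ < ∣ p - q ∣
≢⇒0<∣p-q∣ {p} {q} p≢q with 0ℚ <? ∣ p - q ∣
... | yes 0<∣p-q∣ = 0<∣p-q∣
... | no  0≮∣p-q∣ = contradiction (begin
  p              ≡⟨ solve 2 (λ p q → p := (p :- q) :+ q) refl p q ⟩
  (p - q) + q    ≡⟨ cong (_+ q) (∣p∣≡0⇒p≡0 (p - q) ∣p-q∣≡0) ⟩
  0ℚ + q         ≡⟨ +-identityˡ q ⟩
  q              ∎) p≢q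
  where
  open ≡-Reasoning
  ∣p-q∣≡0 : ∣ p - q ∣ ≡ 0ℚ
  ∣p-q∣≡0 = ≤-antisym (≮⇒≥ 0≮∣p-q∣) (0≤∣p∣ (p - q))

ι : ℤ → ℚ
ι k = k / 1

ι≡mkℚ : ∀ k → ι k ≡ mkℚ k 0 (Coprimality.sym (Coprimality.1-coprimeTo ℤ.∣ k ∣))
ι≡mkℚ k = ↥p/↧p≡p (mkℚ k 0 _)

ι-≤-intro : ∀ {k x} → k ℤ.* ↧ x ℤ.≤ ↥ x → ι k ≤ x
ι-≤-intro {k} {x} h rewrite ι≡mkℚ k = *≤* (subst (k ℤ.* ↧ x ℤ.≤_) (sym (ℤP.*-identityʳ (↥ x))) h)

ι-<-intro : ∀ {k x} → ↥ x ℤ.< k ℤ.* ↧ x → x < ι k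
ι-<-intro {k} {x} h rewrite ι≡mkℚ k = *<* (subst (ℤ._< k ℤ.* ↧ x) (sym (ℤP.*-identityʳ (↥ x))) h)

ι-mono-≤ : ∀ {a b} → a ℤ.≤ b → ι a ≤ ι b
ι-mono-≤ {a} {b} h rewrite ι≡mkℚ a | ι≡mkℚ b = *≤* (ℤP.*-monoʳ-≤-nonNeg 1ℤ h)

ι-cancel-≤ : ∀ {a b} → ι a ≤ ι b → a ℤ.≤ b
ι-cancel-≤ {a} {b} h rewrite ι≡mkℚ a | ι≡mkℚ b = ℤP.*-cancelʳ-≤-pos a b 1ℤ (drop-*≤* h)

ι-cancel-< : ∀ {a b} → ι a < ι b → a ℤ.< b
ι-cancel-< {a} {b} h rewrite ι≡mkℚ a | ι≡mkℚ b = ℤP.*-cancelʳ-<-nonNeg 1ℤ (drop-*<* h)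

ι-neg : ∀ k → ι (ℤ.- k) ≡ - ι k
ι-neg (+ zero)  = refl
ι-neg (+ suc n) = refl
ι-neg -[1+ n ]  = sym (⁻¹-involutive (ι (+ suc n)))

ι-+ : ∀ a b → ι (a ℤ.+ b) ≡ ι a + ι b
ι-+ a b rewrite ι≡mkℚ a | ι≡mkℚ b =
  cong (_/ 1) (sym (cong₂ ℤ._+_ (ℤP.*-identityʳ a) (ℤP.*-identityʳ b)))

ι-cancel-<ℕ : ∀ {a b} → ι (+ a) < ι (+ b) → a ℕ.< b
ι-cancel-<ℕ = ℤP.drop‿+<+ ∘ ι-cancel-<

ι-sucℕ : ∀ a → ι (+ suc a) ≡ ι (+ a) + 1ℚ
ι-sucℕ a = trans (ι-+ 1ℤ (+ a)) (+-comm 1ℚ (ι (+ a)))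

ι-injectiveℕ : ∀ {a b} → ι (+ a) ≡ ι (+ b) → a ≡ b
ι-injectiveℕ e = ℤP.+-injective (ℤP.≤-antisym (ι-cancel-≤ (≤-reflexive e)) (ι-cancel-≤ (≤-reflexive (sym e))))

0≤ιℕ : ∀ a → 0ℚ ≤ ι (+ a)
0≤ιℕ a = ι-mono-≤ {0ℤ} {+ a} (ℤ.+≤+ ℕ.z≤n)

ι-monoℕ-≤ : ∀ {a b} → a ℕ.≤ b → ι (+ a) ≤ ι (+ b)
ι-monoℕ-≤ = ι-mono-≤ ∘ ℤ.+≤+

<⇒1≤∣ι-ι∣ : ∀ {a b} → a ℕ.< b → 1ℚ ≤ ∣ ι (+ a) - ι (+ b) ∣
<⇒1≤∣ι-ι∣ {a} a<b = p+r≤q⇒r≤∣p-q∣ (ι-monoℕ-≤ (ℕP.<⇒≤ a<b)) (subst (_≤ _) (ι-sucℕ a) (ι-monoℕ-≤ a<b))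

≢⇒1≤∣ι-ι∣ : ∀ {a b} → a ≢ b → 1ℚ ≤ ∣ ι (+ a) - ι (+ b) ∣
≢⇒1≤∣ι-ι∣ {a} {b} a≢b with ℕP.<-cmp a b
... | tri< a<b _ _ = <⇒1≤∣ι-ι∣ a<b
... | tri≈ _ a≡b _ = contradiction a≡b a≢b
... | tri> _ _ b<a = subst (1ℚ ≤_) (∣p-q∣≡∣q-p∣ (ι (+ b)) (ι (+ a))) (<⇒1≤∣ι-ι∣ b<a)

floor-lower : ∀ p → ι (floor p) ≤ p
floor-lower p@(mkℚ n d _) = ι-≤-intro {floor p} {p} (ℤDM.[n/d]*d≤n n (+ suc d))

floor-upper : ∀ p → p < ι (ℤ.suc (floor p))
floor-upper p@(mkℚ n d _) = ι-<-intro {ℤ.suc (floor p)} {p}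
  (subst (λ q → n ℤ.< ℤ.suc q ℤ.* + suc d) (sym (ℤDM.div-pos-is-/ℕ n (suc d))) (ℤDM.n<s[n/ℕd]*d n (suc d)))

floor-greatest : ∀ {k} p → ι k ≤ p → k ℤ.≤ floor p
floor-greatest p h = subst (_ ℤ.≤_) (ℤP.pred-suc (floor p))
  (ℤP.i<j⇒i≤pred[j] {j = ℤ.suc (floor p)} (ι-cancel-< (≤-<-trans h (floor-upper p))))

-- `ceiling p` unfolds to `ℤ.- floor (- p)` only once `p` is matched as a record.
ceiling-upper : ∀ p → p ≤ ι (ceiling p)
ceiling-upper p@record{} = subst₂ _≤_ (⁻¹-involutive p) (sym (ι-neg (floor (- p))))
  (neg-antimono-≤ (floor-lower (- p)))

ceiling-least : ∀ {k} p → p ≤ ι k → ceiling p ℤ.≤ k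
ceiling-least {k} p@record{} h = subst (ℤ.- floor (- p) ℤ.≤_) (ℤP.neg-involutive k)
  (ℤP.neg-mono-≤ (floor-greatest (- p) (subst (_≤ - p) (sym (ι-neg k)) (neg-antimono-≤ h))))

floorℕ : ℚ → ℕ
floorℕ p = ℤ.∣ floor p ∣

module _ {p : ℚ} (0≤p : 0ℚ ≤ p) where

  +floorℕ≡floor : + floorℕ p ≡ floor p
  +floorℕ≡floor = ℤP.0≤i⇒+∣i∣≡i (floor-greatest p 0≤p)

  floorℕ-lower : ι (+ floorℕ p) ≤ p
  floorℕ-lower = subst (λ k → ι k ≤ p) (sym +floorℕ≡floor) (floor-lower p)

  floorℕ-upper : p < ι (+ suc (floorℕ p))
  floorℕ-upper = subst (λ k → p < ι (ℤ.suc k)) (sym +floorℕ≡floor) (floor-upper p)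

0≤p⇒+∣ceiling∣≡ceiling : ∀ {p} → 0ℚ ≤ p → + ℤ.∣ ceiling p ∣ ≡ ceiling p
0≤p⇒+∣ceiling∣≡ceiling {p} 0≤p = ℤP.0≤i⇒+∣i∣≡i (ι-cancel-≤ {0ℤ} (≤-trans 0≤p (ceiling-upper p)))

floorℕ-mono-< : ∀ {p q} → 0ℚ ≤ p → 0ℚ ≤ q → p + 1ℚ ≤ q → floorℕ p ℕ.< floorℕ q
floorℕ-mono-< {p} {q} 0≤p 0≤q p+1≤q = ℕ.s≤s⁻¹ (ι-cancel-<ℕ (begin-strict
  ι (+ suc (floorℕ p))  ≡⟨ ι-sucℕ (floorℕ p) ⟩
  ι (+ floorℕ p) + 1ℚ   ≤⟨ +-monoˡ-≤ 1ℚ (floorℕ-lower 0≤p) ⟩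
  p + 1ℚ                ≤⟨ p+1≤q ⟩
  q                     <⟨ floorℕ-upper 0≤q ⟩
  ι (+ suc (floorℕ q))  ∎))
  where open ≤-Reasoning

floorℕ-+ : ∀ {p q} K → 0ℚ ≤ p → 0ℚ ≤ q → q ≤ p + ι (+ K) → floorℕ q ℕ.≤ floorℕ p ℕ.+ K
floorℕ-+ {p} {q} K 0≤p 0≤q q≤p+K = ℕ.s≤s⁻¹ (ι-cancel-<ℕ (begin-strict
  ι (+ floorℕ q)                      ≤⟨ floorℕ-lower 0≤q ⟩
  q                                   ≤⟨ q≤p+K ⟩
  p + ι (+ K)                         <⟨ +-monoˡ-< (ι (+ K)) (floorℕ-upper 0≤p) ⟩
  ι (+ suc (floorℕ p)) + ι (+ K)      ≡⟨ ι-+ (+ suc (floorℕ p)) (+ K) ⟨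
  ι (+ suc (floorℕ p ℕ.+ K))          ∎))
  where open ≤-Reasoning

floorℕ-≤ : ∀ {p} K → 0ℚ ≤ p → p < ι (+ suc K) → floorℕ p ℕ.≤ K
floorℕ-≤ {p} K 0≤p p<K+1 = ℕ.s≤s⁻¹ (ι-cancel-<ℕ (≤-<-trans (floorℕ-lower 0≤p) p<K+1))

χ : ∀ {P : Set} → Dec P → ℕ
χ (yes _) = 1
χ (no _)  = 0

module _ {P Q : Set} where

  χ-mono : (P → Q) → (p? : Dec P) (q? : Dec Q) → χ p? ℕ.≤ χ q?
  χ-mono P⇒Q (yes p) (yes _) = ℕP.≤-refl
  χ-mono P⇒Q (yes p) (no ¬q) = contradiction (P⇒Q p) ¬q
  χ-mono P⇒Q (no _)  q?      = ℕ.z≤n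

  χ-< : ¬ P → Q → (p? : Dec P) (q? : Dec Q) → χ p? ℕ.< χ q?
  χ-< ¬p q (yes p) _      = contradiction p ¬p
  χ-< ¬p q (no _) (yes _) = ℕP.≤-refl
  χ-< ¬p q (no _) (no ¬q) = contradiction q ¬q

  χ-≤suc : (p? : Dec P) (q? : Dec Q) → χ p? ℕ.≤ suc (χ q?)
  χ-≤suc (yes _) q? = ℕ.s≤s ℕ.z≤n
  χ-≤suc (no _)  q? = ℕ.z≤n

  χ-<⇒ : (p? : Dec P) (q? : Dec Q) → χ p? ℕ.< χ q? → ¬ P × Q
  χ-<⇒ (no ¬p) (yes q) _ = ¬p , q
  χ-<⇒ (yes _) (yes _) (ℕ.s≤s ())
  χ-<⇒ (no _)  (no _)  ()
  χ-<⇒ (yes _) (no _)  ()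

sum-mono-≤ : ∀ {n} {f g : Fin n → ℕ} → (∀ i → f i ℕ.≤ g i) → sum f ℕ.≤ sum g
sum-mono-≤ {zero}  f≤g = ℕ.z≤n
sum-mono-≤ {suc n} f≤g = ℕP.+-mono-≤ (f≤g zero) (sum-mono-≤ (f≤g ∘ Fin.suc))

sum-mono-< : ∀ {n} {f g : Fin n → ℕ} → (∀ i → f i ℕ.≤ g i) → ∀ k → f k ℕ.< g k → sum f ℕ.< sum g
sum-mono-< f≤g zero    fk<gk = ℕP.+-mono-<-≤ fk<gk (sum-mono-≤ (f≤g ∘ Fin.suc))
sum-mono-< f≤g (Fin.suc k) fk<gk = ℕP.+-mono-≤-< (f≤g zero) (sum-mono-< (f≤g ∘ Fin.suc) k fk<gk)

sum-≤-suc : ∀ {n} {f g : Fin n → ℕ} → (∀ i → f i ℕ.≤ suc (g i)) →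
  (∀ i j → g i ℕ.< f i → g j ℕ.< f j → i ≡ j) → sum f ℕ.≤ suc (sum g)
sum-≤-suc {zero}  f≤1+g unique = ℕ.z≤n
sum-≤-suc {suc n} {f} {g} f≤1+g unique with g zero ℕ.<? f zero
... | yes g₀<f₀ = ℕP.+-mono-≤ (f≤1+g zero) (sum-mono-≤ (λ i → ℕP.≮⇒≥ (λ gᵢ<fᵢ →
  contradiction (unique zero (Fin.suc i) g₀<f₀ gᵢ<fᵢ) (λ ()))))
... | no g₀≮f₀ = ℕP.≤-trans (ℕP.+-mono-≤ (ℕP.≮⇒≥ g₀≮f₀)
      (sum-≤-suc (f≤1+g ∘ Fin.suc) (λ i j p q → FinP.suc-injective (unique (Fin.suc i) (Fin.suc j) p q))))
  (ℕP.≤-reflexive (ℕP.+-suc (g zero) (sum (g ∘ Fin.suc))))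

m%k≡n%k⇒k∣n∸m : ∀ m n k .{{_ : ℕ.NonZero k}} → m % k ≡ n % k → k ∣ n ℕ.∸ m
m%k≡n%k⇒k∣n∸m m n k m%k≡n%k = divides (qₙ ℕ.∸ qₘ) (begin
  n ℕ.∸ m                                        ≡⟨ cong₂ ℕ._∸_ (ℕDM.m≡m%n+[m/n]*n n k) (ℕDM.m≡m%n+[m/n]*n m k) ⟩
  (n % k ℕ.+ qₙ ℕ.* k) ℕ.∸ (m % k ℕ.+ qₘ ℕ.* k)  ≡⟨ cong (λ r → (n % k ℕ.+ qₙ ℕ.* k) ℕ.∸ (r ℕ.+ qₘ ℕ.* k)) m%k≡n%k ⟩
  (n % k ℕ.+ qₙ ℕ.* k) ℕ.∸ (n % k ℕ.+ qₘ ℕ.* k)  ≡⟨ ℕP.[m+n]∸[m+o]≡n∸o (n % k) (qₙ ℕ.* k) (qₘ ℕ.* k) ⟩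
  qₙ ℕ.* k ℕ.∸ qₘ ℕ.* k                          ≡⟨ ℕP.*-distribʳ-∸ k qₙ qₘ ⟨
  (qₙ ℕ.∸ qₘ) ℕ.* k                              ∎)
  where
  open ≡-Reasoning
  qₘ qₙ : ℕ
  qₘ = m ℕDM./ k
  qₙ = n ℕDM./ k

m<n≤m+k⇒m%[1+k]≢n%[1+k] : ∀ {m n} k → m ℕ.< n → n ℕ.≤ m ℕ.+ k → m % suc k ≢ n % suc k
m<n≤m+k⇒m%[1+k]≢n%[1+k] {m} {n} k m<n n≤m+k m%≡n% = ℕP.<-irrefl refl (begin-strict
  n ℕ.∸ m  ≤⟨ ℕP.m≤n+o⇒m∸n≤o n m n≤m+k ⟩
  k        <⟨ ℕP.n<1+n k ⟩
  suc k    ≤⟨ ∣⇒≤ {{ℕ.>-nonZero (ℕP.m<n⇒0<n∸m m<n)}} (m%k≡n%k⇒k∣n∸m m n (suc k) m%≡n%) ⟩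
  n ℕ.∸ m  ∎)
  where open ℕP.≤-Reasoning

maxL-upper : ∀ {x} xs → x ∈ xs → x ≤ maxL xs
maxL-upper xs x∈xs = foldr-preservesᵒ (λ a b → [ p≤q⇒p≤q⊔r b , p≤q⇒p≤r⊔q a ]′) 0ℚ xs
  (inj₂ (Any.map (λ { refl → ≤-refl }) x∈xs))

maxL-least : ∀ {c} xs → 0ℚ ≤ c → All (_≤ c) xs → maxL xs ≤ c
maxL-least xs 0≤c xs≤c = foldr-preservesᵇ ⊔-lub 0≤c xs≤c

maxL-nonneg : ∀ xs → 0ℚ ≤ maxL xs
maxL-nonneg = foldr-preservesʳ {P = 0ℚ ≤_} (λ x → p≤q⇒p≤r⊔q x) ≤-refl

minL-lower : ∀ {y} xs → y ∈ xs → minL xs ≤ y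
minL-lower (x ∷ xs) y∈ = foldr-preservesᵒ (λ a b → [ p≤q⇒p⊓r≤q b , p≤q⇒r⊓p≤q a ]′) x xs (lift y∈)
  where
  lift : ∀ {y} → y ∈ x ∷ xs → x ≤ y ⊎ Any.Any (_≤ y) xs
  lift (here refl) = inj₁ ≤-refl
  lift (there y∈xs) = inj₂ (Any.map (λ { refl → ≤-refl }) y∈xs)

minL-∈ : ∀ {y} xs → y ∈ xs → minL xs ∈ xs
minL-∈ (x ∷ xs) _ = [ here , there ]′ (foldr-selective ⊓-sel x xs)

∈-if⁺ : ∀ {A : Set} {x : A} {c} → T c → x ∈ (if c then [ x ] else [])
∈-if⁺ {c = true} _ = here refl

∈-if⁻ : ∀ {A : Set} {x y : A} c → x ∈ (if c then [ y ] else []) → T c × x ≡ y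
∈-if⁻ true (here x≡y) = _ , x≡y

-- `pairs n` and `edges G` are, definitionally, `pairsWith` of i < j and of (i < j) ∧ adj G i j.
pairsWith : ∀ {n} → (Fin n → Fin n → Bool) → List (Fin n × Fin n)
pairsWith {n} b = concatMap (λ i → concatMap (λ j →
  if b i j then [ (i , j) ] else []) (allFin n)) (allFin n)

module _ {n} {b : Fin n → Fin n → Bool} where

  ∈-pairsWith⁺ : ∀ {i j} → T (b i j) → (i , j) ∈ pairsWith b
  ∈-pairsWith⁺ {i} {j} bij = ∈-concatMap⁺ _ {xs = allFin n} (Any.map (λ { refl →
    ∈-concatMap⁺ _ {xs = allFin n} (Any.map (λ { refl → ∈-if⁺ bij }) (∈-allFin j)) }) (∈-allFin i))

  ∈-pairsWith⁻ : ∀ {i j} → (i , j) ∈ pairsWith b → T (b i j)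
  ∈-pairsWith⁻ e∈ with Any.satisfied (∈-concatMap⁻ _ {xs = allFin n} e∈)
  ... | i , e∈ᵢ with Any.satisfied (∈-concatMap⁻ _ {xs = allFin n} e∈ᵢ)
  ... | j , e∈ᵢⱼ with ∈-if⁻ (b i j) e∈ᵢⱼ
  ... | bij , refl = bij

dist-comm : ∀ {n} (ρ : Rep n) i j → dist ρ (i , j) ≡ dist ρ (j , i)
dist-comm ρ i j = ∣p-q∣≡∣q-p∣ (ρ i) (ρ j)

dist-∈-either : ∀ {n} (ρ : Rep n) {L} i j → (i , j) ∈ L ⊎ (j , i) ∈ L → dist ρ (i , j) ∈ map (dist ρ) L
dist-∈-either ρ i j (inj₁ ij∈L) = ∈-map⁺ (dist ρ) ij∈L
dist-∈-either ρ i j (inj₂ ji∈L) = subst (_∈ _) (sym (dist-comm ρ i j)) (∈-map⁺ (dist ρ) ji∈L)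

≢⇒<⊎> : ∀ {n} {i j : Fin n} → i ≢ j → toℕ i ℕ.< toℕ j ⊎ toℕ j ℕ.< toℕ i
≢⇒<⊎> {i = i} {j} i≢j with FinP.<-cmp i j
... | tri< i<j _ _ = inj₁ i<j
... | tri≈ _ i≡j _ = contradiction i≡j i≢j
... | tri> _ _ j<i = inj₂ j<i

module _ {n} (G : Graph n) where

  adj⇒≢ : ∀ {i j} → adj G i j ≡ true → i ≢ j
  adj⇒≢ {i} aij refl = contradiction (trans (sym aij) (irrefl G i)) (λ ())

  ∈-edges⁺ : ∀ {i j} → toℕ i ℕ.< toℕ j → adj G i j ≡ true → (i , j) ∈ edges G
  ∈-edges⁺ i<j aij = ∈-pairsWith⁺ (Equivalence.from T-∧ (ℕP.<⇒<ᵇ i<j , Equivalence.from T-≡ aij))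

  ∈-edges⇒adj : ∀ {i j} → (i , j) ∈ edges G → adj G i j ≡ true
  ∈-edges⇒adj ij∈ = Equivalence.to T-≡ (proj₂ (Equivalence.to T-∧ (∈-pairsWith⁻ ij∈)))

  dist-∈-edges : ∀ (ρ : Rep n) {i j} → adj G i j ≡ true → dist ρ (i , j) ∈ map (dist ρ) (edges G)
  dist-∈-edges ρ {i} {j} aij = dist-∈-either ρ i j (Sum.map
    (λ i<j → ∈-edges⁺ i<j aij)
    (λ j<i → ∈-edges⁺ j<i (trans (Graph.sym G j i) aij))
    (≢⇒<⊎> (adj⇒≢ aij)))

module _ {n : ℕ} where

  ∈-pairs⇒≢ : ∀ {i j : Fin n} → (i , j) ∈ pairs n → i ≢ j
  ∈-pairs⇒≢ {i} ij∈ refl = ℕP.<-irrefl refl (ℕP.<ᵇ⇒< (toℕ i) (toℕ i) (∈-pairsWith⁻ ij∈))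

  dist-∈-pairs : ∀ (ρ : Rep n) {i j} → i ≢ j → dist ρ (i , j) ∈ map (dist ρ) (pairs n)
  dist-∈-pairs ρ {i} {j} i≢j = dist-∈-either ρ i j (Sum.map
    (λ i<j → ∈-pairsWith⁺ (ℕP.<⇒<ᵇ i<j))
    (λ j<i → ∈-pairsWith⁺ (ℕP.<⇒<ᵇ j<i))
    (≢⇒<⊎> i≢j))

module _ {n} (ρ : Rep n) (L : List (Fin n × Fin n)) where

  maxOver-least : ∀ {c} → 0ℚ ≤ c → (∀ e → dist ρ e ≤ c) → maxOver L ρ ≤ c
  maxOver-least 0≤c dist≤c = maxL-least _ 0≤c (All.map⁺ (All.universal dist≤c L))

  minOver-elim : (P : ℚ → Set) → (∀ {e} → e ∈ L → P (dist ρ e)) →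
    ∀ {x} → x ∈ map (dist ρ) L → P (minOver L ρ)
  minOver-elim P P-dist x∈ with ∈-map⁻ (dist ρ) (minL-∈ _ x∈)
  ... | e , e∈L , min≡ = subst P (sym min≡) (P-dist e∈L)

module _ {n} (G : Graph n) (ρ : Rep n) {i j} (aij : adj G i j ≡ true) where

  minOver-edges≤ : minOver (edges G) ρ ≤ dist ρ (i , j)
  minOver-edges≤ = minL-lower _ (dist-∈-edges G ρ aij)

  ≤maxOver-edges : dist ρ (i , j) ≤ maxOver (edges G) ρ
  ≤maxOver-edges = maxL-upper _ (dist-∈-edges G ρ aij)

module _ {n} (ρ : Rep n) where

  minOver-pairs≤ : ∀ {i j} → i ≢ j → minOver (pairs n) ρ ≤ dist ρ (i , j)
  minOver-pairs≤ i≢j = minL-lower _ (dist-∈-pairs ρ i≢j)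

  ≤maxOver-pairs : ∀ i j → dist ρ (i , j) ≤ maxOver (pairs n) ρ
  ≤maxOver-pairs i j with i Fin.≟ j
  ... | yes refl = subst (_≤ _) (sym (cong ∣_∣ (+-inverseʳ (ρ i)))) (maxL-nonneg (map (dist ρ) (pairs n)))
  ... | no  i≢j  = maxL-upper _ (dist-∈-pairs ρ i≢j)

module _ {n} (G : Graph n) (hasEdge : HasEdge G) where

  NED⇒0<minOver-edges : ∀ {ρ} → NED G ρ → 0ℚ < minOver (edges G) ρ
  NED⇒0<minOver-edges {ρ} ned = minOver-elim ρ (edges G) (0ℚ <_)
    (λ {(i , j)} ij∈ → ≢⇒0<∣p-q∣ (ned i j (∈-edges⇒adj G ij∈)))
    (dist-∈-edges G ρ (proj₂ (proj₂ hasEdge)))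

  NVD⇒0<minOver-pairs : ∀ {ρ} → NVD ρ → 0ℚ < minOver (pairs n) ρ
  NVD⇒0<minOver-pairs {ρ} nvd = minOver-elim ρ (pairs n) (0ℚ <_)
    (λ {(i , j)} ij∈ → ≢⇒0<∣p-q∣ (∈-pairs⇒≢ ij∈ ∘ nvd))
    (dist-∈-pairs ρ (adj⇒≢ G (proj₂ (proj₂ hasEdge))))

module _ {n} {Adm : Rep n → Set} {num den : Rep n → ℚ} {t : ℚ} (isMin : IsMinRatio Adm num den t) where

  IsMinRatio⇒≤ : ∀ {ρ c} → Adm ρ → 1ℚ ≤ den ρ → num ρ ≤ c → 0ℚ ≤ c → t ≤ c
  IsMinRatio⇒≤ {ρ} {c} adm 1≤den num≤c 0≤c with t ≤? 0ℚ
  ... | yes t≤0 = ≤-trans t≤0 0≤c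
  ... | no  t≰0 = begin
    t          ≡⟨ *-identityʳ t ⟨
    t * 1ℚ     ≤⟨ *-monoˡ-≤-nonNeg t {{nonNegative (<⇒≤ (≰⇒> t≰0))}} 1≤den ⟩
    t * den ρ  ≤⟨ proj₂ isMin ρ adm ⟩
    num ρ      ≤⟨ num≤c ⟩
    c          ∎
    where open ≤-Reasoning

  IsMinRatio⇒0≤ : (∀ {ρ} → Adm ρ → 0ℚ < den ρ) → (∀ ρ → 0ℚ ≤ num ρ) → 0ℚ ≤ t
  IsMinRatio⇒0≤ 0<den 0≤num with proj₁ isMin
  ... | ρ , adm , num≡ = *-cancelʳ-≤-pos (den ρ) {{positive (0<den adm)}}
    (subst₂ _≤_ (sym (*-zeroˡ (den ρ))) num≡ (0≤num ρ))

record Colouring {n} (G : Graph n) (K : ℕ) : Set where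
  field
    colour        : Fin n → ℕ
    colour-≤      : ∀ i → colour i ℕ.≤ K
    colour-proper : ∀ {i j} → adj G i j ≡ true → colour i ≢ colour j

module _ {n} {G : Graph n} {K : ℕ} (C : Colouring G K) (hasEdge : HasEdge G) where

  open Colouring C

  colourRep : Rep n
  colourRep i = ι (+ colour i)

  colourRep-NED : NED G colourRep
  colourRep-NED i j aij = colour-proper aij ∘ ι-injectiveℕ

  1≤minOver-edges : 1ℚ ≤ minOver (edges G) colourRep
  1≤minOver-edges = minOver-elim colourRep (edges G) (1ℚ ≤_)
    (λ ij∈ → ≢⇒1≤∣ι-ι∣ (colour-proper (∈-edges⇒adj G ij∈)))
    (dist-∈-edges G colourRep (proj₂ (proj₂ hasEdge)))

  maxOver-colourRep : ∀ L → maxOver L colourRep ≤ ι (+ K)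
  maxOver-colourRep L = maxOver-least colourRep L (0≤ιℕ K) λ (i , j) →
    0≤p,q≤r⇒∣p-q∣≤r (0≤ιℕ (colour i)) (ι-monoℕ-≤ (colour-≤ i)) (0≤ιℕ (colour j)) (ι-monoℕ-≤ (colour-≤ j))

  colouring⇒dc≤ : ∀ {d} → IsDc1 G d → d ≤ ι (+ K)
  colouring⇒dc≤ isDc = IsMinRatio⇒≤ isDc colourRep-NED 1≤minOver-edges (maxOver-colourRep (edges G)) (0≤ιℕ K)

  colouring⇒pw≤ : ∀ {p} → IsPw1 G p → p ≤ ι (+ K)
  colouring⇒pw≤ isPw = IsMinRatio⇒≤ isPw colourRep-NED 1≤minOver-edges (maxOver-colourRep (pairs n)) (0≤ιℕ K)

orient : ∀ {n} (G : Graph n) (f : Rep n) {R : Fin n → Fin n → Set} →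
  (∀ {i j} → adj G i j ≡ true → f i ≤ f j → R i j) → ∀ {i j} → adj G i j ≡ true → R i j ⊎ R j i
orient G f R-ordered {i} {j} aij with ≤-total (f i) (f j)
... | inj₁ fi≤fj = inj₁ (R-ordered aij fi≤fj)
... | inj₂ fj≤fi = inj₂ (R-ordered (trans (Graph.sym G j i) aij) fj≤fi)

modColouring : ∀ {n} (G : Graph n) K (f : Rep n) (N : Fin n → ℕ) →
  (∀ {i j} → adj G i j ≡ true → f i ≤ f j → N i ℕ.< N j × N j ℕ.≤ N i ℕ.+ K) → Colouring G K
modColouring G K f N spread = record
  { colour        = λ i → N i % suc K
  ; colour-≤      = λ i → ℕ.s≤s⁻¹ (ℕDM.m%n<n (N i) (suc K))
  ; colour-proper = λ aij → [ (λ (<ᵢⱼ , ≤ᵢⱼ) → m<n≤m+k⇒m%[1+k]≢n%[1+k] K <ᵢⱼ ≤ᵢⱼ)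
                            , (λ (<ⱼᵢ , ≤ⱼᵢ) → m<n≤m+k⇒m%[1+k]≢n%[1+k] K <ⱼᵢ ≤ⱼᵢ ∘ sym) ]′ (orient G f spread aij)
  }

module Normalise {n} (ρ : Rep n) (v₀ : Fin n) (m : ℚ) {{_ : Positive m}} where

  instance
    m≢0 : NonZero m
    m≢0 = pos⇒nonZero m

    1/m≥0 : NonNegative (1/ m)
    1/m≥0 = pos⇒nonNeg (1/ m) {{1/pos⇒pos m}}

  vₘᵢₙ : Fin n
  vₘᵢₙ = Extrema.argmin ρ v₀ (allFin n)

  vₘᵢₙ-minimal : ∀ i → ρ vₘᵢₙ ≤ ρ i
  vₘᵢₙ-minimal i = All.lookup (Extrema.f[argmin]≤f[xs] {f = ρ} v₀ (allFin n)) (∈-allFin i)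

  f : Rep n
  f i = (ρ i - ρ vₘᵢₙ) * 1/ m

  scale-≥1 : ∀ {x} → m ≤ x → 1ℚ ≤ x * 1/ m
  scale-≥1 {x} m≤x = subst (_≤ x * 1/ m) (*-inverseʳ m) (*-monoʳ-≤-nonNeg (1/ m) m≤x)

  scale-≤ : ∀ {x} t → x ≤ t * m → x * 1/ m ≤ t
  scale-≤ {x} t x≤tm = subst (x * 1/ m ≤_) (trans (*-assoc t m (1/ m)) (trans (cong (t *_) (*-inverseʳ m)) (*-identityʳ t)))
    (*-monoʳ-≤-nonNeg (1/ m) x≤tm)

  f≡dist : ∀ i → f i ≡ dist ρ (i , vₘᵢₙ) * 1/ m
  f≡dist i = cong (_* 1/ m) (sym (0≤p⇒∣p∣≡p (p≤q⇒0≤q-p (vₘᵢₙ-minimal i))))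

  0≤f : ∀ i → 0ℚ ≤ f i
  0≤f i = subst (_≤ f i) (*-zeroˡ (1/ m)) (*-monoʳ-≤-nonNeg (1/ m) (p≤q⇒0≤q-p (vₘᵢₙ-minimal i)))

  ∣f-f∣≡ : ∀ i j → ∣ f i - f j ∣ ≡ dist ρ (i , j) * 1/ m
  ∣f-f∣≡ i j = begin
    ∣ f i - f j ∣                    ≡⟨ cong ∣_∣ (solve 4 (λ a b c w → (a :- c) :* w :- (b :- c) :* w := (a :- b) :* w)
                                         refl (ρ i) (ρ j) (ρ vₘᵢₙ) (1/ m)) ⟩
    ∣ (ρ i - ρ j) * 1/ m ∣           ≡⟨ ∣p*q∣≡∣p∣*∣q∣ (ρ i - ρ j) (1/ m) ⟩
    ∣ ρ i - ρ j ∣ * ∣ 1/ m ∣         ≡⟨ cong (dist ρ (i , j) *_) (0≤p⇒∣p∣≡p (nonNegative⁻¹ (1/ m))) ⟩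
    dist ρ (i , j) * 1/ m            ∎
    where open ≡-Reasoning

  m≤dist⇒1≤∣f-f∣ : ∀ {i j} → m ≤ dist ρ (i , j) → 1ℚ ≤ ∣ f i - f j ∣
  m≤dist⇒1≤∣f-f∣ {i} {j} m≤dist = subst (1ℚ ≤_) (sym (∣f-f∣≡ i j)) (scale-≥1 m≤dist)

  dist≤tm⇒∣f-f∣≤t : ∀ {i j t} → dist ρ (i , j) ≤ t * m → ∣ f i - f j ∣ ≤ t
  dist≤tm⇒∣f-f∣≤t {i} {j} {t} dist≤tm = subst (_≤ t) (sym (∣f-f∣≡ i j)) (scale-≤ t dist≤tm)

  dist≤tm⇒f≤t : ∀ {i t} → dist ρ (i , vₘᵢₙ) ≤ t * m → f i ≤ t
  dist≤tm⇒f≤t {i} {t} dist≤tm = subst (_≤ t) (sym (f≡dist i)) (scale-≤ t dist≤tm)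

module Rank {n} (f : Rep n) (separated : ∀ {u v} → u ≢ v → 1ℚ ≤ ∣ f u - f v ∣) where

  separated-≤ : ∀ {u v} → u ≢ v → f u ≤ f v → f u + 1ℚ ≤ f v
  separated-≤ u≢v fu≤fv = r≤∣p-q∣⇒p+r≤q fu≤fv (separated u≢v)

  separated-< : ∀ {u v} → u ≢ v → f u ≤ f v → f u < f v
  separated-< {u} u≢v fu≤fv = <-≤-trans (subst (_< f u + 1ℚ) (+-identityʳ (f u)) (+-monoʳ-< (f u) (*<* (ℤ.+<+ ℕP.≤-refl))))
    (separated-≤ u≢v fu≤fv)

  below : ℚ → ℕ
  below x = sum λ w → χ (f w <? x)

  below-mono : ∀ {x y} → (∀ w → f w < x → f w < y) → below x ℕ.≤ below y
  below-mono x⇒y = sum-mono-≤ λ w → χ-mono (x⇒y w) (f w <? _) (f w <? _)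

  below-+1 : ∀ x → below (x + 1ℚ) ℕ.≤ suc (below x)
  below-+1 x = sum-≤-suc (λ w → χ-≤suc (f w <? x + 1ℚ) (f w <? x)) in-window-unique
    where
    in-window : ∀ w → χ (f w <? x) ℕ.< χ (f w <? x + 1ℚ) → x ≤ f w × f w < x + 1ℚ
    in-window w χ< = Product.map₁ ≮⇒≥ (χ-<⇒ (f w <? x) (f w <? x + 1ℚ) χ<)
    apart : ∀ {i j} → i ≢ j → f i ≤ f j → x ≤ f i → f j < x + 1ℚ → ⊥
    apart i≢j fi≤fj x≤fi fj<x+1 =
      <-irrefl refl (<-≤-trans fj<x+1 (≤-trans (+-monoˡ-≤ 1ℚ x≤fi) (separated-≤ i≢j fi≤fj)))
    in-window-unique : ∀ i j → χ (f i <? x) ℕ.< χ (f i <? x + 1ℚ) → χ (f j <? x) ℕ.< χ (f j <? x + 1ℚ) → i ≡ j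
    in-window-unique i j χ<ᵢ χ<ⱼ with i Fin.≟ j | in-window i χ<ᵢ | in-window j χ<ⱼ
    ... | yes i≡j | _ | _ = i≡j
    ... | no i≢j | x≤fi , fi<x+1 | x≤fj , fj<x+1 with ≤-total (f i) (f j)
    ...   | inj₁ fi≤fj = ⊥-elim (apart i≢j fi≤fj x≤fi fj<x+1)
    ...   | inj₂ fj≤fi = ⊥-elim (apart (i≢j ∘ sym) fj≤fi x≤fj fi<x+1)

  below-+ : ∀ K x → below (x + ι (+ K)) ℕ.≤ below x ℕ.+ K
  below-+ zero x = ℕP.≤-reflexive (trans (cong below (+-identityʳ x)) (sym (ℕP.+-identityʳ (below x))))
  below-+ (suc K) x = begin
    below (x + ι (+ suc K))        ≡⟨ cong below (trans (cong (λ y → x + y) (ι-sucℕ K)) (sym (+-assoc x (ι (+ K)) 1ℚ))) ⟩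
    below ((x + ι (+ K)) + 1ℚ)     ≤⟨ below-+1 (x + ι (+ K)) ⟩
    suc (below (x + ι (+ K)))      ≤⟨ ℕ.s≤s (below-+ K x) ⟩
    suc (below x ℕ.+ K)            ≡⟨ ℕP.+-suc (below x) K ⟨
    below x ℕ.+ suc K              ∎
    where open ℕP.≤-Reasoning

  rank : Fin n → ℕ
  rank v = below (f v)

  rank-< : ∀ {u v} → f u < f v → rank u ℕ.< rank v
  rank-< {u} {v} fu<fv = sum-mono-< (λ w → χ-mono (λ fw<fu → <-trans fw<fu fu<fv) (f w <? f u) (f w <? f v))
    u (χ-< (<-irrefl refl) fu<fv (f u <? f u) (f u <? f v))

  rank-≤ : ∀ {u v} K → (∀ w → f w < f v → f w < f u + ι (+ K)) → rank v ℕ.≤ rank u ℕ.+ K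
  rank-≤ {u} {v} K below-v⇒ = ℕP.≤-trans (below-mono below-v⇒) (below-+ K (f u))

module _ {n} (G : Graph n) (hasEdge : HasEdge G) where

  private
    v₀ : Fin n
    v₀ = proj₁ hasEdge

  module EdgeNormalise {ρ : Rep n} (ned : NED G ρ) where

    instance
      minOver-edges>0 : Positive (minOver (edges G) ρ)
      minOver-edges>0 = positive {minOver (edges G) ρ} (NED⇒0<minOver-edges G hasEdge {ρ} ned)

    open Normalise ρ v₀ (minOver (edges G) ρ) public

    floorℕ-<-edge : ∀ {i j} → adj G i j ≡ true → f i ≤ f j → floorℕ (f i) ℕ.< floorℕ (f j)
    floorℕ-<-edge aij fi≤fj =
      floorℕ-mono-< (0≤f _) (0≤f _) (r≤∣p-q∣⇒p+r≤q fi≤fj (m≤dist⇒1≤∣f-f∣ (minOver-edges≤ G ρ aij)))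

  dc⇒colouring : ∀ {d} → IsDc1 G d → ∀ K → d ≤ ι (+ K) → Colouring G K
  dc⇒colouring {d} ((ρ , ned , max≡dm) , _) K d≤K = modColouring G K f (floorℕ ∘ f) λ {i} {j} aij fi≤fj →
    floorℕ-<-edge aij fi≤fj ,
    floorℕ-+ K (0≤f i) (0≤f j) (∣p-q∣≤r⇒q≤p+r fi≤fj
      (≤-trans (dist≤tm⇒∣f-f∣≤t (subst (dist ρ (i , j) ≤_) max≡dm (≤maxOver-edges G ρ aij))) d≤K))
    where open EdgeNormalise ned

  pw⇒colouring : ∀ {p} → IsPw1 G p → ∀ K → p < ι (+ suc K) → Colouring G K
  pw⇒colouring {p} ((ρ , ned , max≡pm) , _) K p<K+1 = modColouring G K f (floorℕ ∘ f) λ {i} {j} aij fi≤fj →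
    floorℕ-<-edge aij fi≤fj ,
    ℕP.≤-trans (floorℕ-≤ K (0≤f j) (≤-<-trans (f≤pw j) p<K+1)) (ℕP.m≤n+m K (floorℕ (f i)))
    where
    open EdgeNormalise ned
    f≤pw : ∀ i → f i ≤ p
    f≤pw i = dist≤tm⇒f≤t (subst (dist ρ (i , vₘᵢₙ) ≤_) max≡pm (≤maxOver-pairs ρ i vₘᵢₙ))

  re⇒colouring : ∀ {r} → IsRe1 G r → ∀ K → r < ι (+ suc K) → Colouring G K
  re⇒colouring {r} ((ρ , nvd , max≡rm) , _) K r<K+1 = modColouring G K f rank λ {i} {j} aij fi≤fj →
    rank-< (separated-< (adj⇒≢ G aij) fi≤fj) , rank-≤ K (below-j⇒ aij fi≤fj)
    where
    m : ℚ
    m = minOver (pairs n) ρ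
    instance
      m>0 : Positive m
      m>0 = positive {m} (NVD⇒0<minOver-pairs G hasEdge {ρ} nvd)
    open Normalise ρ v₀ m
    open Rank f (m≤dist⇒1≤∣f-f∣ ∘ minOver-pairs≤ ρ)
    below-j⇒ : ∀ {i j} → adj G i j ≡ true → f i ≤ f j → ∀ w → f w < f j → f w < f i + ι (+ K)
    below-j⇒ {i} {j} aij fi≤fj w fw<fj = +-cancelʳ-< 1ℚ (begin-strict
      f w + 1ℚ              ≤⟨ separated-≤ (λ { refl → <-irrefl refl fw<fj }) (<⇒≤ fw<fj) ⟩
      f j                   <⟨ ∣p-q∣<r⇒q<p+r fi≤fj (≤-<-trans (dist≤tm⇒∣f-f∣≤t
                                 (subst (dist ρ (i , j) ≤_) max≡rm (≤maxOver-edges G ρ aij))) r<K+1) ⟩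
      f i + ι (+ suc K)     ≡⟨ cong (λ y → f i + y) (ι-sucℕ K) ⟩
      f i + (ι (+ K) + 1ℚ)  ≡⟨ +-assoc (f i) (ι (+ K)) 1ℚ ⟨
      f i + ι (+ K) + 1ℚ    ∎)
      where open ≤-Reasoning

  0≤dc : ∀ {d} → IsDc1 G d → 0ℚ ≤ d
  0≤dc isDc = IsMinRatio⇒0≤ isDc (NED⇒0<minOver-edges G hasEdge) (λ ρ → maxL-nonneg (map (dist ρ) (edges G)))

  0≤pw : ∀ {p} → IsPw1 G p → 0ℚ ≤ p
  0≤pw isPw = IsMinRatio⇒0≤ isPw (NED⇒0<minOver-edges G hasEdge) (λ ρ → maxL-nonneg (map (dist ρ) (pairs n)))

  0≤re : ∀ {r} → IsRe1 G r → 0ℚ ≤ r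
  0≤re isRe = IsMinRatio⇒0≤ isRe (NVD⇒0<minOver-pairs G hasEdge) (λ ρ → maxL-nonneg (map (dist ρ) (edges G)))

  pw≤⌈dc⌉ : ∀ {d p} → IsDc1 G d → IsPw1 G p → p ≤ ι (ceiling d)
  pw≤⌈dc⌉ {d} {p} isDc isPw = subst (λ k → p ≤ ι k) +⌈d⌉≡⌈d⌉
    (colouring⇒pw≤ (dc⇒colouring isDc ℤ.∣ ceiling d ∣ (subst (λ k → d ≤ ι k) (sym +⌈d⌉≡⌈d⌉) (ceiling-upper d))) hasEdge isPw)
    where
    +⌈d⌉≡⌈d⌉ : + ℤ.∣ ceiling d ∣ ≡ ceiling d
    +⌈d⌉≡⌈d⌉ = 0≤p⇒+∣ceiling∣≡ceiling (0≤dc {d} isDc)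

  ⌈dc⌉≤pw : ∀ {d p} → IsDc1 G d → IsPw1 G p → ι (ceiling d) ≤ p
  ⌈dc⌉≤pw {d} {p} isDc isPw = ≤-trans (ι-mono-≤ {ceiling d} {+ floorℕ p} (ceiling-least d
    (colouring⇒dc≤ (pw⇒colouring isPw (floorℕ p) (floorℕ-upper {p} (0≤pw {p} isPw))) hasEdge isDc))) (floorℕ-lower {p} (0≤pw {p} isPw))

  pw≤re : ∀ {p r} → IsPw1 G p → IsRe1 G r → p ≤ r
  pw≤re {p} {r} isPw isRe = ≤-trans
    (colouring⇒pw≤ (re⇒colouring isRe (floorℕ r) (floorℕ-upper {r} (0≤re {r} isRe))) hasEdge isPw) (floorℕ-lower {r} (0≤re {r} isRe))

proposition5 : ∀ (n : ℕ) (G : Graph n) → HasEdge G →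
    ∀ (d p r : ℚ) → IsDc1 G d → IsPw1 G p → IsRe1 G r →
    (ceiling d / 1 ≡ p) × (p ≤ r)
proposition5 n G hasEdge d p r isDc isPw isRe =
  ≤-antisym (⌈dc⌉≤pw G hasEdge {d} {p} isDc isPw) (pw≤⌈dc⌉ G hasEdge {d} {p} isDc isPw) ,
  pw≤re G hasEdge {p} {r} isPw isRe
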